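{- Let $n$ have prime factorization $n=p_1^{e_1}\cdots p_f^{e_f}$ with $p_1<\cdots<p_f$ and all $e_i\ge1$. Let $N=\tau(n)$, let $1\le\ell\le N-1$, and let $v$ be the unique index with $(e_1+1)\cdots(e_{v-1}+1)\mid\ell$ and $(e_1+1)\cdots(e_v+1)\nmid\ell$. Then $d_{\ell+1}(n)/d_\ell(n)\le p_v$.
   Context: $\tau(n)$ is the number of divisors of $n$, and $d_j(n)$ denotes the $j$-th smallest positive divisor of $n$. -}

module Defs where

open import Data.Nat using (ℕ; zero; suc; _*_; _^_)
open import Data.Nat.Divisibility using (_∣?_)
open import Data.List using (List; []; _∷_; filter; applyUpTo; length; take; tabulate)
open import Data.Nat.ListAction using (product)
open import Data.Fin using (Fin)

divisors : ℕ → List ℕ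
divisors n = filter (_∣? n) (applyUpTo suc n)

τ : ℕ → ℕ
τ n = length (divisors n)

nth : List ℕ → ℕ → ℕ
nth []       _       = 0
nth (x ∷ _)  zero    = x
nth (_ ∷ xs) (suc k) = nth xs k

-- d j n : the j-th smallest positive divisor of n (1-based j, 1 ≤ j ≤ τ n).
d : ℕ → ℕ → ℕ
d j n = nth (divisors n) (j Data.Nat.∸ 1)

-- product of g 0, …, g (k-1) (the first k factors, 1-based indices 1..k).
prodFirst : ∀ {f} → (Fin f → ℕ) → ℕ → ℕ
prodFirst g k = product (take k (tabulate g))

{-# OPTIONS --safe #-}
-- Write x = d_ℓ(n), y = d_{ℓ+1}(n) and suppose y > p_v x. The set S of divisors of n that are
-- at most x has ℓ elements, and it is closed under division by p_1, …, p_v and under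
-- multiplication by them inside the divisors of n: a divisor p_i m > x would satisfy
-- y ≤ p_i m ≤ p_v x < y. For such a saturated set, multiplication by p_i matches the elements of
-- p_i-adic valuation k with those of valuation k + 1, so |S| = (e_i + 1) · |S ∩ {p_i ∤ m}|.
-- Peeling off p_1, …, p_v in turn gives (e_1 + 1) ⋯ (e_v + 1) ∣ ℓ, contradicting the choice of v.
module Submission where

open import Defs
open import Data.Nat using (ℕ; suc; _*_; _^_; _≤_; _<_; _∸_)
open import Data.Nat.Divisibility using (_∣_)
open import Data.Nat.Primality using (Prime)
open import Data.Fin using (Fin; toℕ)
open import Data.List using (tabulate)
open import Data.Nat.ListAction using (product)
open import Relation.Binary.PropositionalEquality using (_≡_)
open import Relation.Nullary using (¬_)

open import Level using (Level)
open import Algebra.Properties.CommutativeSemigroup using (interchange; x∙yz≈y∙xz)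
open import Data.Bool.Base using (true; false)
open import Data.Fin.Base using (inject≤) renaming (zero to fzero; suc to fsuc)
open import Data.Fin.Properties
  using (toℕ-injective; toℕ-inject≤; inject≤-injective; toℕ<n; toℕ≤pred[n])
import Data.Fin.Properties as Finₚ
open import Data.List.Base using ([]; _∷_; length; filter; applyUpTo; take)
open import Data.List.Membership.Propositional using (_∈_)
open import Data.List.Membership.Propositional.Properties using (∈-filter⁺; ∈-applyUpTo⁺)
open import Data.List.Properties using (filter-accept; filter-none)
import Data.List.Relation.Unary.All as All
open import Data.List.Relation.Unary.AllPairs using (AllPairs; _∷_)
import Data.List.Relation.Unary.AllPairs.Properties as AllPairs
open import Data.List.Relation.Unary.Any using (here; there)
open import Data.Nat.Base using (zero; _+_; NonZero; z<s; s<s; s≤s)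
open import Data.Nat.Coprimality using (Coprime; coprime-divisor)
open import Data.Nat.Divisibility
  using ( _∣?_; ∣-refl; ∣-trans; ∣⇒≤; ∣1⇒≡1; 0∣⇒≡0; 1∣_; m∣m*n; n∣m*n; ∣n⇒∣m*n; ∣m+n∣m⇒∣n
        ; *-monoʳ-∣; *-cancelˡ-∣)
open import Data.Nat.Primality using (euclidsLemma; prime⇒irreducible; prime⇒nonZero; ¬prime[1])
open import Data.Nat.Properties
open import Data.Product.Base using (∃-syntax; _×_; _,_; proj₁; proj₂)
open import Data.Sum.Base using (inj₁; inj₂; [_,_])
open import Function.Base using (id; _∘_)
open import Function.Definitions using (Injective)
open import Relation.Binary.Definitions using (tri<; tri≈; tri>)
open import Relation.Binary.PropositionalEquality
  using (refl; sym; trans; cong; cong₂; subst; _≢_; module ≡-Reasoning)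
open import Relation.Nullary using (Dec; yes; no; does; _because_; contradiction)
open import Relation.Nullary.Decidable using (_×-dec_; ¬?)
open import Relation.Unary using (Pred; Decidable; _⊆_; _≐_; _∩_; ∁)
open import Relation.Unary.Properties using (_∩?_; ∁?)

open ≡-Reasoning

private variable
  ℓ : Level
  A B : Set ℓ
  P Q : Pred ℕ ℓ

indicator : Dec A → ℕ
indicator (true  because _) = 1
indicator (false because _) = 0

count : Decidable P → ℕ → ℕ
count P? zero    = 0
count P? (suc N) = indicator (P? 0) + count (P? ∘ suc) N

count-cong : (P? : Decidable P) (Q? : Decidable Q) →
  (∀ k → indicator (P? k) ≡ indicator (Q? k)) → ∀ N → count P? N ≡ count Q? N
count-cong P? Q? eq zero    = refl
count-cong P? Q? eq (suc N) = cong₂ _+_ (eq 0) (count-cong (P? ∘ suc) (Q? ∘ suc) (eq ∘ suc) N)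

count-≐ : P ≐ Q → (P? : Decidable P) (Q? : Decidable Q) → ∀ N → count P? N ≡ count Q? N
count-≐ (P⊆Q , Q⊆P) P? Q? = count-cong P? Q? same
  where
  same : ∀ k → indicator (P? k) ≡ indicator (Q? k)
  same k with P? k | Q? k
  ... | yes _ | yes _ = refl
  ... | no  _ | no  _ = refl
  ... | yes p | no ¬q = contradiction (P⊆Q p) ¬q
  ... | no ¬p | yes q = contradiction (Q⊆P q) ¬p

indicator-split : (a? : Dec A) (b? : Dec B) →
  indicator a? ≡ indicator (a? ×-dec b?) + indicator (a? ×-dec ¬? b?)
indicator-split (yes _) (yes _) = refl
indicator-split (yes _) (no  _) = refl
indicator-split (no  _) _       = refl

count-∩-∁ : (P? : Decidable P) (Q? : Decidable Q) →
  ∀ N → count P? N ≡ count (P? ∩? Q?) N + count (P? ∩? ∁? Q?) N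
count-∩-∁ P? Q? zero    = refl
count-∩-∁ P? Q? (suc N) = begin
  indicator (P? 0) + count (P? ∘ suc) N
    ≡⟨ cong₂ _+_ (indicator-split (P? 0) (Q? 0)) (count-∩-∁ (P? ∘ suc) (Q? ∘ suc) N) ⟩
  (a + a′) + (c + c′)
    ≡⟨ interchange +-commutativeSemigroup a a′ c c′ ⟩
  (a + c) + (a′ + c′)
    ∎
  where
  a a′ c c′ : ℕ
  a  = indicator (P? 0 ×-dec Q? 0)
  a′ = indicator (P? 0 ×-dec ¬? (Q? 0))
  c  = count ((P? ∩? Q?) ∘ suc) N
  c′ = count ((P? ∩? ∁? Q?) ∘ suc) N

count-+ : (P? : Decidable P) → ∀ M N → count P? (M + N) ≡ count P? M + count (P? ∘ (M +_)) N
count-+ P? zero    N = refl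
count-+ P? (suc M) N =
  trans (cong (indicator (P? 0) +_) (count-+ (P? ∘ suc) M N))
        (sym (+-assoc (indicator (P? 0)) (count (P? ∘ suc) M) (count (P? ∘ suc ∘ (M +_)) N)))

count-none : (P? : Decidable P) → ∀ N → (∀ {k} → k < N → ¬ P k) → count P? N ≡ 0
count-none P? zero    _    = refl
count-none P? (suc N) none with P? 0
... | yes P0 = contradiction P0 (none z<s)
... | no  _  = count-none (P? ∘ suc) N (none ∘ s<s)

count-⊆< : (P? : Decidable P) {N N′ : ℕ} → P ⊆ (_< N) → N ≤ N′ → count P? N′ ≡ count P? N
count-⊆< {P = P} P? {N} {N′} P<N N≤N′ = begin
  count P? N′                                ≡⟨ cong (count P?) (sym (m+[n∸m]≡n N≤N′)) ⟩
  count P? (N + (N′ ∸ N))                    ≡⟨ count-+ P? N (N′ ∸ N) ⟩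
  count P? N + count (P? ∘ (N +_)) (N′ ∸ N)  ≡⟨ cong (count P? N +_) (count-none _ (N′ ∸ N) beyond) ⟩
  count P? N + 0                             ≡⟨ +-identityʳ _ ⟩
  count P? N                                 ∎
  where
  beyond : ∀ {k} → k < N′ ∸ N → ¬ P (N + k)
  beyond _ = m+n≮m N _ ∘ P<N

count-* : (P? : Decidable P) (q : ℕ) .{{_ : NonZero q}} → P ⊆ (q ∣_) →
  ∀ M → count P? (q * M) ≡ count (P? ∘ (q *_)) M
count-* P? q P∣ zero = cong (count P?) (*-zeroʳ q)
count-* {P = P} P? q@(suc q′) P∣ (suc M) = begin
  count P? (q * suc M)
    ≡⟨ cong (count P?) (*-suc q M) ⟩
  count P? (q + q * M)
    ≡⟨ count-+ P? q (q * M) ⟩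
  count P? q + count (P? ∘ (q +_)) (q * M)
    ≡⟨ cong₂ _+_ first-block (count-* (P? ∘ (q +_)) q shifted M) ⟩
  indicator (P? (q * 0)) + count (P? ∘ (q +_) ∘ (q *_)) M
    ≡⟨ cong (_ +_) (count-cong _ _ (λ k → cong (indicator ∘ P?) (sym (*-suc q k))) M) ⟩
  count (P? ∘ (q *_)) (suc M)
    ∎
  where
  shifted : (P ∘ (q +_)) ⊆ (q ∣_)
  shifted Pq+k = ∣m+n∣m⇒∣n (P∣ Pq+k) ∣-refl
  inside : ∀ {k} → k < q′ → ¬ P (suc k)
  inside k<q′ = <⇒≱ (s<s k<q′) ∘ ∣⇒≤ ∘ P∣
  first-block : count P? q ≡ indicator (P? (q * 0))
  first-block = begin
    indicator (P? 0) + count (P? ∘ suc) q′  ≡⟨ cong (_ +_) (count-none _ q′ inside) ⟩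
    indicator (P? 0) + 0                   ≡⟨ +-identityʳ _ ⟩
    indicator (P? 0)                       ≡⟨ cong (indicator ∘ P?) (sym (*-zeroʳ q)) ⟩
    indicator (P? (q * 0))                 ∎

prime∤1 : ∀ {p} → Prime p → ¬ p ∣ 1
prime∤1 p-prime p∣1 = ¬prime[1] (subst Prime (∣1⇒≡1 p∣1) p-prime)

prime∣prime⇒≡ : ∀ {p q} → Prime p → Prime q → p ∣ q → p ≡ q
prime∣prime⇒≡ p-prime q-prime p∣q with prime⇒irreducible q-prime p∣q
... | inj₁ p≡1 = contradiction (subst Prime p≡1 p-prime) ¬prime[1]
... | inj₂ p≡q = p≡q

prime∣^⇒∣ : ∀ {p m} k → Prime p → p ∣ m ^ k → p ∣ m
prime∣^⇒∣ zero    p-prime p∣1 = contradiction p∣1 (prime∤1 p-prime)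
prime∣^⇒∣ {m = m} (suc k) p-prime p∣m^k+1 =
  [ id , prime∣^⇒∣ k p-prime ] (euclidsLemma m (m ^ k) p-prime p∣m^k+1)

prime∤* : ∀ {p m n} → Prime p → ¬ p ∣ m → ¬ p ∣ n → ¬ p ∣ m * n
prime∤* {m = m} {n} p-prime p∤m p∤n p∣mn = [ p∤m , p∤n ] (euclidsLemma m n p-prime p∣mn)

prime∤^ : ∀ {p q} k → Prime p → Prime q → p ≢ q → ¬ p ∣ q ^ k
prime∤^ k p-prime q-prime p≢q = p≢q ∘ prime∣prime⇒≡ p-prime q-prime ∘ prime∣^⇒∣ k p-prime

prime∤⇒coprime : ∀ {p m} → Prime p → ¬ p ∣ m → Coprime m p
prime∤⇒coprime p-prime p∤m (d∣m , d∣p) with prime⇒irreducible p-prime d∣p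
... | inj₁ d≡1  = d≡1
... | inj₂ refl = contradiction d∣m p∤m

infix 4 _^_∥_

_^_∥_ : ℕ → ℕ → ℕ → Set
p ^ k ∥ n = ∃[ r ] n ≡ p ^ k * r × ¬ p ∣ r

prime∤product-^ : ∀ {f q} (p e : Fin f → ℕ) → Prime q → (∀ i → Prime (p i)) → (∀ i → q ≢ p i) →
  ¬ q ∣ product (tabulate (λ i → p i ^ e i))
prime∤product-^ {zero}  p e q-prime p-prime q≢p = prime∤1 q-prime
prime∤product-^ {suc f} p e q-prime p-prime q≢p =
  prime∤* q-prime (prime∤^ (e fzero) q-prime (p-prime fzero) (q≢p fzero))
    (prime∤product-^ (p ∘ fsuc) (e ∘ fsuc) q-prime (p-prime ∘ fsuc) (q≢p ∘ fsuc))

product-^-∥ : ∀ {f} (p e : Fin f → ℕ) → (∀ i → Prime (p i)) → Injective _≡_ _≡_ p →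
  ∀ i → p i ^ e i ∥ product (tabulate (λ i → p i ^ e i))
product-^-∥ p e p-prime p-inj fzero =
  _ , refl , prime∤product-^ (p ∘ fsuc) (e ∘ fsuc) (p-prime fzero) (p-prime ∘ fsuc)
               (λ i p₀≡pᵢ → contradiction (p-inj p₀≡pᵢ) λ ())
product-^-∥ p e p-prime p-inj (fsuc i)
  with r , rest≡ , pᵢ∤r ←
         product-^-∥ (p ∘ fsuc) (e ∘ fsuc) (p-prime ∘ fsuc) (Finₚ.suc-injective ∘ p-inj) i =
  p₀^e₀ * r ,
  trans (cong (p₀^e₀ *_) rest≡) (x∙yz≈y∙xz *-commutativeSemigroup p₀^e₀ (p (fsuc i) ^ e (fsuc i)) r) ,
  prime∤* (p-prime (fsuc i)) (prime∤^ (e fzero) (p-prime (fsuc i)) (p-prime fzero) pᵢ≢p₀) pᵢ∤r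
  where
  p₀^e₀ : ℕ
  p₀^e₀ = p fzero ^ e fzero
  pᵢ≢p₀ : p (fsuc i) ≢ p fzero
  pᵢ≢p₀ pᵢ≡p₀ = contradiction (p-inj pᵢ≡p₀) λ ()

record Saturated (q n : ℕ) (S : Pred ℕ ℓ) : Set ℓ where
  field
    *-closed : ∀ {m} → S m → q * m ∣ n → S (q * m)
    /-closed : ∀ {m} → S (q * m) → S m

open Saturated

module _ {p : ℕ} (p-prime : Prime p) where

  private instance
    p≢0 : NonZero p
    p≢0 = prime⇒nonZero p-prime

  -- The multiples of p in S are p · S′ for S′ = S ∘ (p *_), a saturated set of divisors of
  -- n / p with the same elements coprime to p; this drives the induction on e.
  count-saturated : ∀ {e n N} {S : Pred ℕ ℓ} (S? : Decidable S) → p ^ e ∥ n →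
    S ⊆ (_< N) → S ⊆ (_∣ n) → Saturated p n S →
    count S? N ≡ suc e * count (S? ∩? ∁? (p ∣?_)) N
  count-saturated {e = zero} {N = N} {S} S? (r , refl , p∤r) S<N S∣n _ = begin
    count S? N                   ≡⟨ count-∩-∁ S? (p ∣?_) N ⟩
    count (S? ∩? (p ∣?_)) N + c  ≡⟨ cong (_+ c) (count-none _ N λ _ (Sm , p∣m) → p∤r (p∣r Sm p∣m)) ⟩
    c                            ≡⟨ sym (+-identityʳ c) ⟩
    1 * c                        ∎
    where
    c : ℕ
    c = count (S? ∩? ∁? (p ∣?_)) N
    p∣r : ∀ {m} → S m → p ∣ m → p ∣ r
    p∣r {m} Sm p∣m = ∣-trans p∣m (subst (m ∣_) (*-identityˡ r) (S∣n Sm))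
  count-saturated {e = suc e} {N = N} {S} S? (r , refl , p∤r) S<N S∣n sat = begin
    count S? N
      ≡⟨ count-∩-∁ S? (p ∣?_) N ⟩
    count (S? ∩? (p ∣?_)) N + c
      ≡⟨ cong (_+ c) multiples ⟩
    count S′? N + c
      ≡⟨ cong (_+ c) (count-saturated {e = e} S′? (r , refl , p∤r) S′<N S′∣n′ sat′) ⟩
    suc e * count (S′? ∩? ∁? (p ∣?_)) N + c
      ≡⟨ cong (λ c′ → suc e * c′ + c) (count-≐ coprime-parts _ _ N) ⟩
    suc e * c + c
      ≡⟨ +-comm (suc e * c) c ⟩
    suc (suc e) * c
      ∎
    where
    n′ : ℕ
    n′ = p ^ e * r
    ∣p*n′ : ∀ {m} → m ∣ p ^ suc e * r → m ∣ p * n′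
    ∣p*n′ {m} = subst (m ∣_) (*-assoc p (p ^ e) r)
    ∣n : ∀ {m} → m ∣ p * n′ → m ∣ p ^ suc e * r
    ∣n {m} = subst (m ∣_) (sym (*-assoc p (p ^ e) r))
    c : ℕ
    c = count (S? ∩? ∁? (p ∣?_)) N
    S′ : Pred ℕ _
    S′ = S ∘ (p *_)
    S′? : Decidable S′
    S′? = S? ∘ (p *_)
    S′<N : S′ ⊆ (_< N)
    S′<N {m} Spm = ≤-<-trans (m≤n*m m p) (S<N Spm)
    S′∣n′ : S′ ⊆ (_∣ n′)
    S′∣n′ Spm = *-cancelˡ-∣ p (∣p*n′ (S∣n Spm))
    sat′ : Saturated p n′ S′
    sat′ = record
      { *-closed = λ Spm pm∣n′ → *-closed sat Spm (∣n (*-monoʳ-∣ p pm∣n′))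
      ; /-closed = /-closed sat
      }
    pm∣n : ∀ {m} → S m → ¬ p ∣ m → p * m ∣ p ^ suc e * r
    pm∣n Sm p∤m =
      ∣n (*-monoʳ-∣ p (coprime-divisor (prime∤⇒coprime p-prime p∤m) (∣p*n′ (S∣n Sm))))
    coprime-parts : (S′ ∩ ∁ (p ∣_)) ≐ (S ∩ ∁ (p ∣_))
    coprime-parts = (λ (Spm , p∤m) → /-closed sat Spm , p∤m)
                  , (λ (Sm , p∤m) → *-closed sat Sm (pm∣n Sm p∤m) , p∤m)
    multiples : count (S? ∩? (p ∣?_)) N ≡ count S′? N
    multiples = begin
      count (S? ∩? (p ∣?_)) N
        ≡⟨ sym (count-⊆< (S? ∩? (p ∣?_)) (S<N ∘ proj₁) (m≤n*m N p)) ⟩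
      count (S? ∩? (p ∣?_)) (p * N)
        ≡⟨ count-* (S? ∩? (p ∣?_)) p proj₂ N ⟩
      count ((S? ∩? (p ∣?_)) ∘ (p *_)) N
        ≡⟨ count-≐ (proj₁ , λ Spm → Spm , m∣m*n _) _ _ N ⟩
      count S′? N
        ∎

product-∣-count : ∀ {j n N} (q a : Fin j → ℕ) → (∀ i → Prime (q i)) → Injective _≡_ _≡_ q →
  (∀ i → q i ^ a i ∥ n) → {S : Pred ℕ ℓ} (S? : Decidable S) →
  S ⊆ (_< N) → S ⊆ (_∣ n) → (∀ i → Saturated (q i) n S) →
  product (tabulate (suc ∘ a)) ∣ count S? N
product-∣-count {j = zero} q a q-prime q-inj q∥n S? S<N S∣n sat = 1∣ _
product-∣-count {j = suc j} {n} {N} q a q-prime q-inj q∥n {S} S? S<N S∣n sat =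
  subst (_ ∣_) (sym count≡) (*-monoʳ-∣ (suc (a fzero)) product∣count₀)
  where
  q₀ : ℕ
  q₀ = q fzero
  S₀? : Decidable (S ∩ ∁ (q₀ ∣_))
  S₀? = S? ∩? ∁? (q₀ ∣?_)
  count≡ : count S? N ≡ suc (a fzero) * count S₀? N
  count≡ = count-saturated (q-prime fzero) {e = a fzero} S? (q∥n fzero) S<N S∣n (sat fzero)
  sat₀ : ∀ i → Saturated (q (fsuc i)) n (S ∩ ∁ (q₀ ∣_))
  sat₀ i = record
    { *-closed = λ (Sm , q₀∤m) qm∣n →
        *-closed (sat (fsuc i)) Sm qm∣n , prime∤* (q-prime fzero) q₀∤qᵢ q₀∤m
    ; /-closed = λ (Sqm , q₀∤qm) → /-closed (sat (fsuc i)) Sqm , q₀∤qm ∘ ∣n⇒∣m*n (q (fsuc i))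
    }
    where
    q₀∤qᵢ : ¬ q₀ ∣ q (fsuc i)
    q₀∤qᵢ = (λ ()) ∘ q-inj ∘ prime∣prime⇒≡ (q-prime fzero) (q-prime (fsuc i))
  product∣count₀ : product (tabulate (suc ∘ a ∘ fsuc)) ∣ count S₀? N
  product∣count₀ = product-∣-count (q ∘ fsuc) (a ∘ fsuc) (q-prime ∘ fsuc) (Finₚ.suc-injective ∘ q-inj)
    (q∥n ∘ fsuc) S₀? (S<N ∘ proj₁) (S∣n ∘ proj₁) sat₀

take-tabulate : ∀ {k f} (k≤f : k ≤ f) (g : Fin f → A) →
  take k (tabulate g) ≡ tabulate (g ∘ λ i → inject≤ i k≤f)
take-tabulate {k = zero}              _         g = refl
take-tabulate {k = suc k} {f = suc f} (s≤s k≤f) g = cong (g fzero ∷_) (take-tabulate k≤f (g ∘ fsuc))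

module _ {f : ℕ} {p : Fin f → ℕ} (p-< : ∀ i j → toℕ i < toℕ j → p i < p j) where

  strictlyIncreasing⇒injective : Injective _≡_ _≡_ p
  strictlyIncreasing⇒injective {i} {j} pᵢ≡pⱼ with <-cmp (toℕ i) (toℕ j)
  ... | tri< i<j _ _ = contradiction pᵢ≡pⱼ (<⇒≢ (p-< i j i<j))
  ... | tri≈ _ i≡j _ = toℕ-injective i≡j
  ... | tri> _ _ j<i = contradiction (sym pᵢ≡pⱼ) (<⇒≢ (p-< j i j<i))

  strictlyIncreasing⇒monotone : ∀ {i j} → toℕ i ≤ toℕ j → p i ≤ p j
  strictlyIncreasing⇒monotone {i} {j} i≤j with m≤n⇒m<n∨m≡n i≤j
  ... | inj₁ i<j = <⇒≤ (p-< i j i<j)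
  ... | inj₂ i≡j = ≤-reflexive (cong p (toℕ-injective i≡j))

nth-∈ : ∀ xs {i} → i < length xs → nth xs i ∈ xs
nth-∈ (x ∷ xs) {zero}  _         = here refl
nth-∈ (x ∷ xs) {suc i} (s≤s i<n) = there (nth-∈ xs i<n)

length-filter-≤-nth : ∀ {xs} → AllPairs _<_ xs → ∀ {i} → i < length xs →
  length (filter (_≤? nth xs i) xs) ≡ suc i
length-filter-≤-nth {x ∷ xs} (x<xs ∷ _) {zero} _ = begin
  length (filter (_≤? x) (x ∷ xs))  ≡⟨ cong length (filter-accept (_≤? x) ≤-refl) ⟩
  suc (length (filter (_≤? x) xs))  ≡⟨ cong (suc ∘ length) (filter-none (_≤? x) (All.map <⇒≱ x<xs)) ⟩
  1                                 ∎
length-filter-≤-nth {x ∷ xs} (x<xs ∷ sorted) {suc i} (s≤s i<n) = begin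
  length (filter (_≤? y) (x ∷ xs))  ≡⟨ cong length (filter-accept (_≤? y) x≤y) ⟩
  suc (length (filter (_≤? y) xs))  ≡⟨ cong suc (length-filter-≤-nth sorted i<n) ⟩
  suc (suc i)                       ∎
  where
  y : ℕ
  y = nth xs i
  x≤y : x ≤ y
  x≤y = <⇒≤ (All.lookup x<xs (nth-∈ xs i<n))

nth-suc-≤ : ∀ {xs} → AllPairs _<_ xs → ∀ {i z} → suc i < length xs → z ∈ xs → nth xs i < z →
  nth xs (suc i) ≤ z
nth-suc-≤ (_ ∷ _)        {zero} _ (here refl)          x<x = contradiction x<x (<-irrefl refl)
nth-suc-≤ (_ ∷ _ ∷ _)    {zero} _ (there (here refl))  _   = ≤-refl
nth-suc-≤ (_ ∷ y<ys ∷ _) {zero} _ (there (there z∈ys)) _   = <⇒≤ (All.lookup y<ys z∈ys)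
nth-suc-≤ {_ ∷ xs} (x<xs ∷ _) {suc i} (s≤s i<n) (here refl) xᵢ<x =
  contradiction (All.lookup x<xs (nth-∈ xs (<⇒≤ i<n))) (<-asym xᵢ<x)
nth-suc-≤ (_ ∷ sorted) {suc i} (s≤s i<n) (there z∈xs) xᵢ<z = nth-suc-≤ sorted i<n z∈xs xᵢ<z

filter-∩ : (P? : Decidable P) (Q? : Decidable Q) →
  ∀ xs → filter (P? ∩? Q?) xs ≡ filter Q? (filter P? xs)
filter-∩ P? Q? []       = refl
filter-∩ P? Q? (x ∷ xs) with does (P? x)
... | false = filter-∩ P? Q? xs
... | true with does (Q? x)
...   | false = filter-∩ P? Q? xs
...   | true  = cong (x ∷_) (filter-∩ P? Q? xs)

length-filter-applyUpTo : (P? : Decidable P) →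
  ∀ f N → length (filter P? (applyUpTo f N)) ≡ count (P? ∘ f) N
length-filter-applyUpTo P? f zero    = refl
length-filter-applyUpTo P? f (suc N) with P? (f 0)
... | yes _ = cong suc (length-filter-applyUpTo P? (f ∘ suc) N)
... | no  _ = length-filter-applyUpTo P? (f ∘ suc) N

divisors-sorted : ∀ n → AllPairs _<_ (divisors n)
divisors-sorted n = AllPairs.filter⁺ (_∣? n) (AllPairs.applyUpTo⁺₁ suc n (λ i<j _ → s<s i<j))

∈-divisors : ∀ {m n} → m ∣ suc n → m ∈ divisors (suc n)
∈-divisors {zero}      0∣n with () ← 0∣⇒≡0 0∣n
∈-divisors {suc m} {n} m∣n = ∈-filter⁺ (_∣? suc n) (∈-applyUpTo⁺ suc (∣⇒≤ m∣n)) m∣n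

count-divisors-≤-nth : ∀ n {i} → i < τ n →
  count ((_∣? n) ∩? (_≤? nth (divisors n) i)) (suc n) ≡ suc i
-- The term of the count at 0 vanishes by computation, since 0 ∤ suc n.
count-divisors-≤-nth (suc n) {i} i<τ = begin
  count (D? ∘ suc) (suc n)
    ≡⟨ sym (length-filter-applyUpTo D? suc (suc n)) ⟩
  length (filter D? (applyUpTo suc (suc n)))
    ≡⟨ cong length (filter-∩ (_∣? suc n) (_≤? x) (applyUpTo suc (suc n))) ⟩
  length (filter (_≤? x) (divisors (suc n)))
    ≡⟨ length-filter-≤-nth (divisors-sorted (suc n)) i<τ ⟩
  suc i
    ∎
  where
  x : ℕ
  x = nth (divisors (suc n)) i
  D? : Decidable ((_∣ suc n) ∩ (_≤ x))
  D? = (_∣? suc n) ∩? (_≤? x)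

wide-gap⇒product-∣-index : ∀ {j n i} (q a : Fin j → ℕ) → (∀ k → Prime (q k)) → Injective _≡_ _≡_ q →
  (∀ k → q k ^ a k ∥ n) → suc i < τ n →
  (∀ k → q k * nth (divisors n) i < nth (divisors n) (suc i)) →
  product (tabulate (suc ∘ a)) ∣ suc i
wide-gap⇒product-∣-index {n = suc n} {i} q a q-prime q-inj q∥n i+1<τ gap =
  subst (product (tabulate (suc ∘ a)) ∣_) (count-divisors-≤-nth (suc n) (<⇒≤ i+1<τ))
    (product-∣-count q a q-prime q-inj q∥n S? (s≤s ∘ ∣⇒≤ ∘ proj₁) proj₁ saturated)
  where
  x : ℕ
  x = nth (divisors (suc n)) i
  S? : Decidable ((_∣ suc n) ∩ (_≤ x))
  S? = (_∣? suc n) ∩? (_≤? x)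
  saturated : ∀ k → Saturated (q k) (suc n) ((_∣ suc n) ∩ (_≤ x))
  saturated k = record
    { *-closed = λ {m} (_ , m≤x) qm∣n → qm∣n , ≮⇒≥ λ x<qm →
        <⇒≱ (gap k) (≤-trans (nth-suc-≤ (divisors-sorted (suc n)) i+1<τ (∈-divisors qm∣n) x<qm)
                              (*-monoʳ-≤ (q k) m≤x))
    ; /-closed = λ {m} (qm∣n , qm≤x) →
        ∣-trans (n∣m*n (q k)) qm∣n , ≤-trans (m≤n*m m (q k) {{prime⇒nonZero (q-prime k)}}) qm≤x
    }

lemma7p1 : (n f : ℕ) (p e : Fin f → ℕ) →
    (∀ i → Prime (p i)) →
    (∀ i j → toℕ i < toℕ j → p i < p j) →
    (∀ i → 1 ≤ e i) →
    n ≡ product (tabulate (λ i → p i ^ e i)) →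
    (ℓ : ℕ) → 1 ≤ ℓ → ℓ ≤ τ n ∸ 1 →
    (v : Fin f) →
    prodFirst (λ i → suc (e i)) (toℕ v) ∣ ℓ →
    ¬ (prodFirst (λ i → suc (e i)) (suc (toℕ v)) ∣ ℓ) →
    d (suc ℓ) n ≤ p v * d ℓ n
lemma7p1 n f p e p-prime p-< _ n≡ (suc i) _ ℓ<τ v _ ∤ℓ with d (suc (suc i)) n ≤? p v * d (suc i) n
... | yes y≤pᵥx = y≤pᵥx
... | no  y≰pᵥx = contradiction (subst (_∣ suc i) first-factors product∣ℓ) ∤ℓ
  where
  ι : Fin (suc (toℕ v)) → Fin f
  ι k = inject≤ k (toℕ<n v)
  p-inj : Injective _≡_ _≡_ p
  p-inj = strictlyIncreasing⇒injective p-<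
  first-factors : product (tabulate (suc ∘ e ∘ ι)) ≡ prodFirst (λ i → suc (e i)) (suc (toℕ v))
  first-factors = cong product (sym (take-tabulate (toℕ<n v) (λ i → suc (e i))))
  pₖx<y : ∀ k → p (ι k) * d (suc i) n < d (suc (suc i)) n
  pₖx<y k = ≤-<-trans (*-monoˡ-≤ _ (strictlyIncreasing⇒monotone p-< ιk≤v)) (≰⇒> y≰pᵥx)
    where
    ιk≤v : toℕ (ι k) ≤ toℕ v
    ιk≤v = ≤-trans (≤-reflexive (toℕ-inject≤ k _)) (toℕ≤pred[n] k)
  product∣ℓ : product (tabulate (suc ∘ e ∘ ι)) ∣ suc i
  product∣ℓ = wide-gap⇒product-∣-index (p ∘ ι) (e ∘ ι) (p-prime ∘ ι) (inject≤-injective _ _ _ _ ∘ p-inj)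
    (λ k → subst (p (ι k) ^ e (ι k) ∥_) (sym n≡) (product-^-∥ p e p-prime p-inj (ι k)))
    (pred-cancel-< ℓ<τ) pₖx<y
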